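{- Let $s,k$ be positive integers and let $\lambda$ be a self-conjugate partition. Then $\lambda$ is an $(s,s+1,\ldots,s+k)$-core if and only if $MD(\lambda)$ is a nice order ideal of the poset $P(s,k)$.
   Context: A partition $\lambda$ is identified with its Young diagram; it is self-conjugate if it equals its reflection in the main diagonal. The hook length of a box is the number of boxes weakly to its right in its row plus those strictly below it in its column; $MD(\lambda)$ denotes the set of hook lengths of the boxes on the main diagonal. $\lambda$ is a $t$-core if no box has hook length divisible by $t$, and an $(s,s+1,\ldots,s+k)$-core if it is a $t$-core for every $s\le t\le s+k$. Define $L(s,k)=\bigcup_{j\ge0}\{2i-1+2sj : i\in\mathbb{Z},\ jk+1\le i\le\lfloor s/2\rfloor\}$ and $R(s,k)=\bigcup_{j\ge0}\{2i-1+2sj : i\in\mathbb{Z},\ jk+\lceil(s+k)/2\rceil+1\le i\le s\}$, and $P(s,k)=L(s,k)\cup R(s,k)$, partially ordered by the order generated by the cover relations: for $x,y\in P(s,k)$, $y$ covers $x$ iff $y=x+2s+2t$ for some integer $0\le t\le k$. An order ideal is a subset $I$ such that $y\in I$ and $x\preceq y$ imply $x\in I$. An order ideal $I$ of $P(s,k)$ is nice if there are no elements $h_1,h_2\in I$ with $h_1+h_2\in\{2s,2s+2,\ldots,2s+2k\}$. -}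

module Defs where

open import Data.Nat using (ℕ; zero; suc; _+_; _*_; _∸_; _≤_; _<_; _≥_; ⌊_/2⌋; ⌈_/2⌉; _<ᵇ_)
open import Data.Nat.Divisibility using (_∣_)
open import Data.List using (List; []; _∷_; length; filter)
open import Data.List.Relation.Unary.All using (All)
open import Data.List.Relation.Unary.Linked using (Linked)
open import Data.Product using (Σ; _×_)
open import Relation.Binary.PropositionalEquality using (_≡_)
open import Relation.Nullary using (¬_)
open import Data.Nat using (_<?_)

IsPartition : List ℕ → Set
IsPartition la = Linked _≥_ la × All (λ x → 0 < x) la

-- the i-th part (0-indexed), 0 beyond the length
part : List ℕ → ℕ → ℕ
part []       i       = 0
part (x ∷ xs) zero    = x
part (x ∷ xs) (suc i) = part xs i

-- the j-th part of the conjugate partition: number of parts > j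
conjPart : List ℕ → ℕ → ℕ
conjPart la j = length (filter (j <?_) la)

SelfConjugate : List ℕ → Set
SelfConjugate la = ∀ j → conjPart la j ≡ part la j

-- box (i,j) (0-indexed row i, column j) lies in the diagram iff j < λ_i
InDiagram : List ℕ → ℕ → ℕ → Set
InDiagram la i j = j < part la i

-- hook length: boxes weakly right in the row + boxes strictly below in the column
hook : List ℕ → ℕ → ℕ → ℕ
hook la i j = (part la i ∸ j) + (conjPart la j ∸ suc i)

IsCore : ℕ → List ℕ → Set
IsCore t la = ∀ i j → InDiagram la i j → ¬ (t ∣ hook la i j)

IsMultiCore : ℕ → ℕ → List ℕ → Set
IsMultiCore s k la = ∀ t → s ≤ t → t ≤ s + k → IsCore t la

MD : List ℕ → ℕ → Set
MD la h = Σ ℕ λ i → InDiagram la i i × hook la i i ≡ h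

-- L(s,k), R(s,k), P(s,k) (i ≥ 1 in both cases since jk+1 ≥ 1, so 2i-1 is natural)
InL : ℕ → ℕ → ℕ → Set
InL s k x = Σ ℕ λ j → Σ ℕ λ i → (j * k + 1 ≤ i) × (i ≤ ⌊ s /2⌋) × (x ≡ (2 * i ∸ 1) + 2 * s * j)

InR : ℕ → ℕ → ℕ → Set
InR s k x = Σ ℕ λ j → Σ ℕ λ i → (j * k + ⌈ s + k /2⌉ + 1 ≤ i) × (i ≤ s) × (x ≡ (2 * i ∸ 1) + 2 * s * j)

data InP (s k x : ℕ) : Set where
  inL : InL s k x → InP s k x
  inR : InR s k x → InP s k x

Covers : ℕ → ℕ → ℕ → ℕ → Set
Covers s k x y = Σ ℕ λ t → t ≤ k × y ≡ x + 2 * s + 2 * t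

data Below (s k : ℕ) : ℕ → ℕ → Set where
  here : ∀ {x} → Below s k x x
  step : ∀ {x y z} → Below s k x y → InP s k y → InP s k z → Covers s k y z → Below s k x z

IsOrderIdeal : ℕ → ℕ → (ℕ → Set) → Set
IsOrderIdeal s k I = (∀ x → I x → InP s k x)
                   × (∀ x y → InP s k x → InP s k y → Below s k x y → I y → I x)

IsNice : ℕ → ℕ → (ℕ → Set) → Set
IsNice s k I = ¬ (Σ ℕ λ h₁ → Σ ℕ λ h₂ → Σ ℕ λ t →
                   I h₁ × I h₂ × t ≤ k × h₁ + h₂ ≡ 2 * s + 2 * t)

NiceOrderIdeal : ℕ → ℕ → (ℕ → Set) → Set
NiceOrderIdeal s k I = IsOrderIdeal s k I × IsNice s k I

module Submission where

-- The proof factors through two conditions on a set D of odd numbers: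
--   ShiftClosed t D :  h ∈ D and h > 2t imply h − 2t ∈ D,
--   SumFree t D     :  no h₁, h₂ ∈ D satisfy h₁ + h₂ = 2t.
-- 1. (Sets of odd numbers.)  Shift-closure may be iterated, and together
--    with sum-freeness for 2t it gives sum-freeness for every 2qt.
-- 2. (Partitions.)  Parts decrease, and the conjugate is dual to the parts.
-- 3. (Self-conjugate diagrams.)  Hooks are computed from λ_i + λ_j; MD(λ)
--    consists of the numbers 2a + 1 for the diagonal rows λ_i = i + 1 + a.
-- 4. (Cores.)  For self-conjugate λ:  λ is a t-core iff MD(λ) is
--    t-shift-closed and t-sum-free.
-- 5. (The poset.)  Writing elements as 2u + 1 + 2sj with 0 ≤ u < s, P(s,k)
--    is a union of "bands" in u; a set of odd numbers satisfies both
--    conditions for all t ∈ [s, s+k] iff it is a nice order ideal of P(s,k).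
-- The theorem is the conjunction of 4 (for every t ∈ [s, s+k]) and 5.

open import Defs
open import Data.Nat
  using (ℕ; zero; suc; _+_; _*_; _∸_; _≤_; _<_; _≥_; z≤n; s≤s; s≤s⁻¹; z<s;
         ⌊_/2⌋; ⌈_/2⌉; _≤?_; _<?_; _≟_; NonZero; >-nonZero)
open import Data.Nat.Properties
open import Data.Nat.DivMod using (_/_; _%_; m≡m%n+[m/n]*n; m%n<n)
open import Data.Nat.Divisibility using (_∣_; divides; ∣-reflexive)
open import Data.Nat.Tactic.RingSolver using (solve-∀)
open import Data.List using (List; []; _∷_; length)
open import Data.List.Properties using (filter-accept; filter-reject)
open import Data.List.Relation.Unary.Linked using (Linked; head; tail)
open import Data.Product using (Σ; _×_; _,_; proj₁; proj₂; map₂)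
open import Data.Sum using (_⊎_; inj₁; inj₂)
open import Data.Empty using (⊥; ⊥-elim)
open import Relation.Nullary using (¬_; Dec; yes; no)
open import Relation.Binary.PropositionalEquality
  using (_≡_; _≢_; refl; sym; trans; cong; cong₂; subst; module ≡-Reasoning)
open import Function.Bundles using (_⇔_; mk⇔)

-- 1. Sets of odd numbers

Odd : (ℕ → Set) → Set
Odd D = ∀ h → D h → Σ ℕ λ a → h ≡ suc (2 * a)

ShiftClosed : ℕ → (ℕ → Set) → Set
ShiftClosed t D = ∀ h → D h → 2 * t < h → D (h ∸ 2 * t)

SumFree : ℕ → (ℕ → Set) → Set
SumFree t D = ∀ h₁ h₂ → D h₁ → D h₂ → h₁ + h₂ ≡ 2 * t → ⊥

MultiConditions : ℕ → ℕ → (ℕ → Set) → Set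
MultiConditions s k D = ∀ t → s ≤ t → t ≤ s + k → ShiftClosed t D × SumFree t D

odd-sum : ∀ a₁ a₂ → suc (2 * a₁) + suc (2 * a₂) ≡ 2 * suc (a₁ + a₂)
odd-sum = solve-∀

odd-sum-half : ∀ a₁ a₂ {t} → suc (2 * a₁) + suc (2 * a₂) ≡ 2 * t → suc (a₁ + a₂) ≡ t
odd-sum-half a₁ a₂ {t} eq = *-cancelˡ-≡ (suc (a₁ + a₂)) t 2 (trans (sym (odd-sum a₁ a₂)) eq)

odd-shift : ∀ {a t} → t ≤ a → suc (2 * a) ∸ 2 * t ≡ suc (2 * (a ∸ t))
odd-shift {a} {t} t≤a = begin
  suc (2 * a) ∸ 2 * t                ≡⟨ cong (λ z → suc (2 * z) ∸ 2 * t) (sym (m∸n+n≡m t≤a)) ⟩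
  suc (2 * (a ∸ t + t)) ∸ 2 * t      ≡⟨ cong (_∸ 2 * t) (split (a ∸ t) t) ⟩
  suc (2 * (a ∸ t)) + 2 * t ∸ 2 * t  ≡⟨ m+n∸n≡m (suc (2 * (a ∸ t))) (2 * t) ⟩
  suc (2 * (a ∸ t))                  ∎
  where
  open ≡-Reasoning
  split : ∀ m t → suc (2 * (m + t)) ≡ suc (2 * m) + 2 * t
  split = solve-∀

shiftDown : ∀ {D : ℕ → Set} {t x} → ShiftClosed t D → 0 < x → D (x + 2 * t) → D x
shiftDown {D} {t} {x} closed x>0 d =
  subst D (m+n∸n≡m x (2 * t)) (closed (x + 2 * t) d (m<n+m (2 * t) x>0))

shiftDownMany : ∀ {D : ℕ → Set} {t} → ShiftClosed t D →
                ∀ q e → D (suc (2 * (e + q * t))) → D (suc (2 * e))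
shiftDownMany {D} closed zero e d = subst (λ z → D (suc (2 * z))) (+-identityʳ e) d
shiftDownMany {D} {t} closed (suc q) e d =
  shiftDownMany closed q e (shiftDown {t = t} closed z<s (subst D (peel e q t) d))
  where
  peel : ∀ e q t → suc (2 * (e + suc q * t)) ≡ suc (2 * (e + q * t)) + 2 * t
  peel = solve-∀

-- Sum-freeness for 2t propagates to all multiples 2qt: shifting the larger
-- summand down by 2t passes from 2(q+2)t to 2(q+1)t, and two elements that
-- are both below 2t sum to less than 4t.
module _ {D : ℕ → Set} {t : ℕ} (odd : Odd D) (closed : ShiftClosed t D) where

  -- An odd element is never 2t itself.
  below-2t : ∀ h → D h → ¬ (2 * t < h) → h < 2 * t
  below-2t h dh h≯2t with odd h dh
  ... | a , refl = ≤∧≢⇒< (≮⇒≥ h≯2t) (λ eq → even≢odd t a (sym eq))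

  unfold : ∀ q t → 2 * (suc (suc q) * t) ≡ 2 * (suc q * t) + 2 * t
  unfold = solve-∀

  sumFree-step : ∀ q → SumFree (suc q * t) D → SumFree (suc (suc q) * t) D
  sumFree-step q free h₁ h₂ d₁ d₂ sum with 2 * t <? h₁ | 2 * t <? h₂
  ... | yes big₁ | _ = free (h₁ ∸ 2 * t) h₂ (closed h₁ d₁ big₁) d₂ (+-cancelʳ-≡ (2 * t) _ _ (begin
        h₁ ∸ 2 * t + h₂ + 2 * t     ≡⟨ +-assoc (h₁ ∸ 2 * t) h₂ (2 * t) ⟩
        h₁ ∸ 2 * t + (h₂ + 2 * t)   ≡⟨ cong (h₁ ∸ 2 * t +_) (+-comm h₂ (2 * t)) ⟩
        h₁ ∸ 2 * t + (2 * t + h₂)   ≡⟨ sym (+-assoc (h₁ ∸ 2 * t) (2 * t) h₂) ⟩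
        h₁ ∸ 2 * t + 2 * t + h₂     ≡⟨ cong (_+ h₂) (m∸n+n≡m (<⇒≤ big₁)) ⟩
        h₁ + h₂                     ≡⟨ sum ⟩
        2 * (suc (suc q) * t)       ≡⟨ unfold q t ⟩
        2 * (suc q * t) + 2 * t     ∎))
    where open ≡-Reasoning
  ... | no _ | yes big₂ = free h₁ (h₂ ∸ 2 * t) d₁ (closed h₂ d₂ big₂) (+-cancelʳ-≡ (2 * t) _ _ (begin
        h₁ + (h₂ ∸ 2 * t) + 2 * t   ≡⟨ +-assoc h₁ (h₂ ∸ 2 * t) (2 * t) ⟩
        h₁ + (h₂ ∸ 2 * t + 2 * t)   ≡⟨ cong (h₁ +_) (m∸n+n≡m (<⇒≤ big₂)) ⟩
        h₁ + h₂                     ≡⟨ sum ⟩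
        2 * (suc (suc q) * t)       ≡⟨ unfold q t ⟩
        2 * (suc q * t) + 2 * t     ∎))
    where open ≡-Reasoning
  ... | no small₁ | no small₂ = <-irrefl sum (begin-strict
        h₁ + h₂                      <⟨ +-mono-< (below-2t h₁ d₁ small₁) (below-2t h₂ d₂ small₂) ⟩
        2 * t + 2 * t                ≤⟨ m≤m+n (2 * t + 2 * t) (2 * (q * t)) ⟩
        2 * t + 2 * t + 2 * (q * t)  ≡⟨ regroup q t ⟩
        2 * (suc (suc q) * t)        ∎)
    where
    open ≤-Reasoning
    regroup : ∀ q t → 2 * t + 2 * t + 2 * (q * t) ≡ 2 * (suc (suc q) * t)
    regroup = solve-∀

  sumFreeMultiples : SumFree t D → ∀ q → SumFree (q * t) D
  sumFreeMultiples free zero h₁ h₂ d₁ d₂ sum with odd h₁ d₁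
  ... | a , refl with trans sum (cong (2 *_) (*-zeroˡ t))
  ... | ()
  sumFreeMultiples free (suc zero) h₁ h₂ d₁ d₂ sum =
    free h₁ h₂ d₁ d₂ (trans sum (cong (2 *_) (+-identityʳ t)))
  sumFreeMultiples free (suc (suc q)) = sumFree-step q (sumFreeMultiples free (suc q))

-- 2. Partitions

head-≥ : ∀ {x xs} → Linked _≥_ (x ∷ xs) → part xs 0 ≤ x
head-≥ {xs = []}    _  = z≤n
head-≥ {xs = _ ∷ _} lk = head lk

part-antitone : ∀ {la} → Linked _≥_ la → ∀ {r r'} → r ≤ r' → part la r' ≤ part la r
part-antitone {[]}     _  _ = z≤n
part-antitone {x ∷ xs} lk {zero}  {zero}   _  = ≤-refl
part-antitone {x ∷ xs} lk {zero}  {suc r'} _  = ≤-trans (part-antitone (tail lk) {0} {r'} z≤n) (head-≥ lk)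
part-antitone {x ∷ xs} lk {suc r} {suc r'} le = part-antitone (tail lk) (s≤s⁻¹ le)

part-beyond : ∀ la {i} → length la ≤ i → part la i ≡ 0
part-beyond []       _  = refl
part-beyond (x ∷ xs) {suc i} le = part-beyond xs (s≤s⁻¹ le)

conjPart-∷-< : ∀ {x} xs {j} → j < x → conjPart (x ∷ xs) j ≡ suc (conjPart xs j)
conjPart-∷-< xs {j} j<x = cong length (filter-accept (j <?_) j<x)

conjPart-∷-≮ : ∀ {x} xs {j} → ¬ (j < x) → conjPart (x ∷ xs) j ≡ conjPart xs j
conjPart-∷-≮ xs {j} j≮x = cong length (filter-reject (j <?_) j≮x)

conjPart-∷-≤ : ∀ x xs j → conjPart (x ∷ xs) j ≤ suc (conjPart xs j)
conjPart-∷-≤ x xs j with j <? x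
... | yes j<x = ≤-reflexive (conjPart-∷-< xs j<x)
... | no  j≮x = ≤-trans (≤-reflexive (conjPart-∷-≮ xs j≮x)) (n≤1+n _)

conjPart-> : ∀ {la} → Linked _≥_ la → ∀ i j → j < part la i → i < conjPart la j
conjPart-> {x ∷ xs} lk zero    j j<x = subst (0 <_) (sym (conjPart-∷-< xs j<x)) z<s
conjPart-> {x ∷ xs} lk (suc i) j j<λ =
  subst (suc i <_) (sym (conjPart-∷-< xs (<-≤-trans j<λ (part-antitone lk {0} {suc i} z≤n))))
        (s≤s (conjPart-> (tail lk) i j j<λ))

conjPart-≤ : ∀ {la} → Linked _≥_ la → ∀ i j → part la i ≤ j → conjPart la j ≤ i
conjPart-≤ {[]}     lk i       j _   = z≤n
conjPart-≤ {x ∷ xs} lk zero    j x≤j =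
  subst (_≤ 0) (sym (conjPart-∷-≮ xs (≤⇒≯ x≤j)))
        (conjPart-≤ (tail lk) zero j (≤-trans (head-≥ lk) x≤j))
conjPart-≤ {x ∷ xs} lk (suc i) j λ≤j = ≤-trans (conjPart-∷-≤ x xs j) (s≤s (conjPart-≤ (tail lk) i j λ≤j))

firstFailure : (G : ℕ → Set) → (∀ i → Dec (G i)) → ∀ N → G 0 → ¬ G N →
               Σ ℕ λ i → G i × ¬ G (suc i)
firstFailure G dec zero    g₀ ¬g = ⊥-elim (¬g g₀)
firstFailure G dec (suc N) g₀ ¬g with dec N
... | yes gN = N , gN , ¬g
... | no ¬gN = firstFailure G dec N g₀ ¬gN

-- 3. Self-conjugate diagrams

module SelfConjugateDiagram (la : List ℕ) (lk : Linked _≥_ la) (sc : SelfConjugate la) where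

  p : ℕ → ℕ
  p = part la

  -- In a self-conjugate diagram the arm and the leg of box (i,j) end at
  -- λ_i and λ'_j = λ_j, so  hook(i,j) + j + (i + 1) = λ_i + λ_j.
  hook-sum : ∀ i j → j < p i → hook la i j + (j + suc i) ≡ p i + p j
  hook-sum i j j<λ = begin
    (p i ∸ j) + (conjPart la j ∸ suc i) + (j + suc i)  ≡⟨ interchange (p i ∸ j) _ j (suc i) ⟩
    (p i ∸ j + j) + (conjPart la j ∸ suc i + suc i)    ≡⟨ cong₂ _+_ (m∸n+n≡m (<⇒≤ j<λ))
                                                                     (m∸n+n≡m (conjPart-> lk i j j<λ)) ⟩
    p i + conjPart la j                                ≡⟨ cong (p i +_) (sc j) ⟩
    p i + p j                                          ∎
    where
    open ≡-Reasoning
    interchange : ∀ a b c d → a + b + (c + d) ≡ (a + c) + (b + d)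
    interchange = solve-∀

  hook-from-sum : ∀ i j → j < p i → ∀ v → v + (j + suc i) ≡ p i + p j → hook la i j ≡ v
  hook-from-sum i j j<λ v eq = +-cancelʳ-≡ (j + suc i) (hook la i j) v (trans (hook-sum i j j<λ) (sym eq))

  hook-sym : ∀ i j → j < p i → i < p j × hook la i j ≡ hook la j i
  hook-sym i j j<λ = i<λ , +-cancelʳ-≡ (j + suc i) _ _ (begin
    hook la i j + (j + suc i)  ≡⟨ hook-sum i j j<λ ⟩
    p i + p j                  ≡⟨ +-comm (p i) (p j) ⟩
    p j + p i                  ≡⟨ sym (hook-sum j i i<λ) ⟩
    hook la j i + (i + suc j)  ≡⟨ cong (hook la j i +_) (flip i j) ⟩
    hook la j i + (j + suc i)  ∎)
    where
    open ≡-Reasoning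
    i<λ : i < p j
    i<λ = subst (i <_) (sc j) (conjPart-> lk i j j<λ)
    flip : ∀ i j → i + suc j ≡ j + suc i
    flip = solve-∀

  -- λ_i + λ_j ≠ i + j + 1: if (i,j) is a box then λ_i > j and λ_j > i;
  -- otherwise λ_i ≤ j and λ_j ≤ i.
  parts-sum≢ : ∀ i j → p i + p j ≢ suc (i + j)
  parts-sum≢ i j eq with j <? p i
  ... | yes j<λ = <-irrefl (sym eq) (begin-strict
        suc (i + j)    ≡⟨ cong suc (+-comm i j) ⟩
        suc (j + i)    <⟨ s≤s (+-monoʳ-< j (n<1+n i)) ⟩
        suc j + suc i  ≤⟨ +-mono-≤ j<λ (proj₁ (hook-sym i j j<λ)) ⟩
        p i + p j      ∎)
    where open ≤-Reasoning
  ... | no j≮λ = <-irrefl eq (begin-strict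
        p i + p j    ≤⟨ +-mono-≤ (≮⇒≥ j≮λ) (subst (_≤ i) (sc j) (conjPart-≤ lk i j (≮⇒≥ j≮λ))) ⟩
        j + i        ≡⟨ +-comm j i ⟩
        i + j        <⟨ n<1+n (i + j) ⟩
        suc (i + j)  ∎)
    where open ≤-Reasoning

  -- Row i meets the diagonal with arm a when λ_i = i + 1 + a.
  DiagonalRow : ℕ → Set
  DiagonalRow a = Σ ℕ λ i → p i ≡ i + suc a

  diagonal-in : ∀ {i a} → p i ≡ i + suc a → i < p i
  diagonal-in {i} eq = subst (i <_) (sym eq) (m<m+n i z<s)

  diagonal-arm : ∀ i → i < p i → p i ≡ i + suc (p i ∸ suc i)
  diagonal-arm i i<λ = trans (sym (m+[n∸m]≡n i<λ)) (sym (+-suc i (p i ∸ suc i)))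

  crossing-inside : ∀ {i₁ i₂ a₂} → i₁ ≤ i₂ → p i₂ ≡ i₂ + suc a₂ → i₂ < p i₁
  crossing-inside le e₂ = <-≤-trans (diagonal-in e₂) (part-antitone lk le)

  crossing-hook : ∀ {i₁ i₂ a₁ a₂} → i₂ < p i₁ → p i₁ ≡ i₁ + suc a₁ → p i₂ ≡ i₂ + suc a₂ →
                  hook la i₁ i₂ ≡ suc (a₁ + a₂)
  crossing-hook {i₁} {i₂} {a₁} {a₂} inside e₁ e₂ = hook-from-sum i₁ i₂ inside (suc (a₁ + a₂)) (begin
    suc (a₁ + a₂) + (i₂ + suc i₁)  ≡⟨ regroup i₁ i₂ a₁ a₂ ⟩
    (i₁ + suc a₁) + (i₂ + suc a₂)  ≡⟨ sym (cong₂ _+_ e₁ e₂) ⟩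
    p i₁ + p i₂                    ∎)
    where
    open ≡-Reasoning
    regroup : ∀ i₁ i₂ a₁ a₂ → suc (a₁ + a₂) + (i₂ + suc i₁) ≡ (i₁ + suc a₁) + (i₂ + suc a₂)
    regroup = solve-∀

  diagonal-hook : ∀ {i a} → p i ≡ i + suc a → hook la i i ≡ suc (2 * a)
  diagonal-hook {i} {a} e =
    trans (crossing-hook (diagonal-in e) e e) (cong (λ z → suc (a + z)) (sym (+-identityʳ a)))

  diagonalRow→MD : ∀ {a} → DiagonalRow a → MD la (suc (2 * a))
  diagonalRow→MD (i , e) = i , diagonal-in e , diagonal-hook e

  MD→diagonalRow : ∀ {h} → MD la h → Σ ℕ λ a → h ≡ suc (2 * a) × DiagonalRow a
  MD→diagonalRow (i , i<λ , refl) = p i ∸ suc i , diagonal-hook arm , (i , arm)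
    where
    arm : p i ≡ i + suc (p i ∸ suc i)
    arm = diagonal-arm i i<λ

  MD-odd : Odd (MD la)
  MD-odd h m = proj₁ (MD→diagonalRow m) , proj₁ (proj₂ (MD→diagonalRow m))

  MD→diagonalRow′ : ∀ {a} → MD la (suc (2 * a)) → DiagonalRow a
  MD→diagonalRow′ {a} m with MD→diagonalRow m
  ... | b , eq , row = subst DiagonalRow (sym (*-cancelˡ-≡ a b 2 (suc-injective eq))) row

  -- Take i with
  -- i ≤ λ_i + m but i + 1 > λ_{i+1} + m (beyond the last row the inequality
  -- fails).  If i = λ_i + m, row i works; otherwise column j = i − m has
  -- length exactly i + 1, so row j of the conjugate λ′ = λ has arm m.
  rowOrDiagonal : ∀ m → (Σ ℕ λ j → p j + m ≡ j) ⊎ DiagonalRow m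
  rowOrDiagonal m with firstFailure (λ i → i ≤ p i + m) (λ i → i ≤? p i + m) (length la + suc m) z≤n beyond
    where
    beyond : ¬ (length la + suc m ≤ p (length la + suc m) + m)
    beyond le = ≤⇒≯ (subst (λ z → length la + suc m ≤ z + m) (part-beyond la (m≤m+n (length la) (suc m))) le)
                    (m≤n+m (suc m) (length la))
  ... | i , i≤ , i+1≰ with i ≟ p i + m
  ... | yes i≡ = inj₁ (i , sym i≡)
  ... | no  i≢ = inj₂ (j , (begin
        p j            ≡⟨ sym (sc j) ⟩
        conjPart la j  ≡⟨ ≤-antisym upper lower ⟩
        suc i          ≡⟨ cong suc i≡j+m ⟩
        suc (j + m)    ≡⟨ sym (+-suc j m) ⟩
        j + suc m      ∎))
    where
    open ≡-Reasoning
    next : p (suc i) + m ≤ i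
    next = s≤s⁻¹ (≰⇒> i+1≰)
    j : ℕ
    j = i ∸ m
    i≡j+m : i ≡ j + m
    i≡j+m = sym (m∸n+n≡m (m+n≤o⇒n≤o (p (suc i)) next))
    upper : conjPart la j ≤ suc i
    upper = conjPart-≤ lk (suc i) j (+-cancelʳ-≤ m (p (suc i)) j (subst (p (suc i) + m ≤_) i≡j+m next))
    lower : suc i ≤ conjPart la j
    lower = conjPart-> lk i j (+-cancelʳ-≤ m (suc j) (p i) (subst (_≤ p i + m) (cong suc i≡j+m) (≤∧≢⇒< i≤ i≢)))

  -- A row j ending m boxes before the diagonal and a diagonal row i with
  -- arm m + n cross in a box: otherwise λ_i ≤ j, so λ_j ≤ i and
  -- j = λ_j + m ≤ i + m < λ_i.
  stop-inside : ∀ {i j m n} → p i ≡ i + suc (m + n) → p j + m ≡ j → j < p i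
  stop-inside {i} {j} {m} {n} ei ej with j <? p i
  ... | yes j<λ = j<λ
  ... | no  j≮λ = ⊥-elim (<-irrefl refl (begin-strict
        j                ≡⟨ sym ej ⟩
        p j + m          ≤⟨ +-monoˡ-≤ m (subst (_≤ i) (sc j) (conjPart-≤ lk i j (≮⇒≥ j≮λ))) ⟩
        i + m            <⟨ +-monoʳ-< i (s≤s (m≤m+n m n)) ⟩
        i + suc (m + n)  ≡⟨ sym ei ⟩
        p i              ≤⟨ ≮⇒≥ j≮λ ⟩
        j                ∎))
    where open ≤-Reasoning

  arm-excess : ∀ {i j a e} → j < p i → p i ≡ i + suc a → p j + e ≡ j → hook la i j + e ≡ a
  arm-excess {i} {j} {a} {e} j<λ ei ej = +-cancelʳ-≡ (p j + suc i) _ _ (begin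
    hook la i j + e + (p j + suc i)    ≡⟨ regroup (hook la i j) e (p j) i ⟩
    hook la i j + ((p j + e) + suc i)  ≡⟨ cong (λ z → hook la i j + (z + suc i)) ej ⟩
    hook la i j + (j + suc i)          ≡⟨ hook-sum i j j<λ ⟩
    p i + p j                          ≡⟨ cong (_+ p j) ei ⟩
    (i + suc a) + p j                  ≡⟨ regroup′ i a (p j) ⟩
    a + (p j + suc i)                  ∎)
    where
    open ≡-Reasoning
    regroup : ∀ H e P i → H + e + (P + suc i) ≡ H + ((P + e) + suc i)
    regroup = solve-∀
    regroup′ : ∀ i a P → (i + suc a) + P ≡ a + (P + suc i)
    regroup′ = solve-∀

  stop-hook : ∀ {i j m n} → p i ≡ i + suc (m + n) → p j + m ≡ j → hook la i j ≡ n
  stop-hook {i} {j} {m} {n} ei ej =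
    +-cancelʳ-≡ m (hook la i j) n (trans (arm-excess (stop-inside ei ej) ei ej) (+-comm m n))

-- 4. Cores of a self-conjugate partition via MD(λ)

module CoreCriterion (la : List ℕ) (lk : Linked _≥_ la) (sc : SelfConjugate la) (t : ℕ) where
  open SelfConjugateDiagram la lk sc

  -- Diagonal hooks 2a₁ + 1 and 2a₂ + 1 summing to 2t would put the hook
  -- length a₁ + a₂ + 1 = t at the crossing of their rows.
  core⇒sumFree : IsCore t la → SumFree t (MD la)
  core⇒sumFree core h₁ h₂ m₁ m₂ sum with MD→diagonalRow m₁ | MD→diagonalRow m₂
  ... | a₁ , refl , (i₁ , e₁) | a₂ , refl , (i₂ , e₂) with ≤-total i₁ i₂
  ...   | inj₁ i₁≤i₂ = core i₁ i₂ inside (∣-reflexive (sym (trans (crossing-hook inside e₁ e₂)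
                                                              (odd-sum-half a₁ a₂ sum))))
    where
    inside : i₂ < p i₁
    inside = crossing-inside i₁≤i₂ e₂
  ...   | inj₂ i₂≤i₁ = core i₂ i₁ inside (∣-reflexive (sym (trans (crossing-hook inside e₂ e₁)
                                                              (odd-sum-half a₂ a₁ (trans (+-comm (suc (2 * a₂)) _) sum)))))
    where
    inside : i₁ < p i₂
    inside = crossing-inside i₂≤i₁ e₁

  -- If 2a + 1 ∈ MD(λ) and a ≥ t, put m = a − t.  By rowOrDiagonal either a
  -- diagonal row of arm m exists, giving 2a + 1 − 2t ∈ MD(λ), or stop-hook
  -- produces a box of hook length t.
  core⇒shiftClosed : IsCore t la → ShiftClosed t (MD la)
  core⇒shiftClosed core h mh big with MD→diagonalRow mh
  ... | a , refl , (i , ei) = shift (rowOrDiagonal (a ∸ t))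
    where
    t≤a : t ≤ a
    t≤a = *-cancelˡ-≤ 2 (s≤s⁻¹ big)
    shift : (Σ ℕ λ j → p j + (a ∸ t) ≡ j) ⊎ DiagonalRow (a ∸ t) → MD la (suc (2 * a) ∸ 2 * t)
    shift (inj₂ row) = subst (MD la) (sym (odd-shift t≤a)) (diagonalRow→MD row)
    shift (inj₁ (j , ej)) = ⊥-elim (core i j (stop-inside ei′ ej) (∣-reflexive (sym (stop-hook ei′ ej))))
      where
      ei′ : p i ≡ i + suc (a ∸ t + t)
      ei′ = trans ei (cong (λ z → i + suc z) (sym (m∸n+n≡m t≤a)))

  module _ (closed : ShiftClosed t (MD la)) (free : SumFree t (MD la)) where

    -- A box (i,j) in a diagonal row i of arm a whose column j meets the
    -- diagonal too (arm b) has hook a + b + 1, and (2a + 1) + (2b + 1) is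
    -- twice the hook; so the hook is not a multiple qt.
    crossing-box : ∀ i j q → i < p i → j < p j → j < p i → hook la i j ≢ q * t
    crossing-box i j q i<λ j<λj j<λ hq = sumFreeMultiples MD-odd closed free q _ _
        (diagonalRow→MD (i , ei)) (diagonalRow→MD (j , ej)) (begin
      suc (2 * a) + suc (2 * b)  ≡⟨ odd-sum a b ⟩
      2 * suc (a + b)            ≡⟨ cong (2 *_) (sym (crossing-hook j<λ ei ej)) ⟩
      2 * hook la i j            ≡⟨ cong (2 *_) hq ⟩
      2 * (q * t)                ∎)
      where
      open ≡-Reasoning
      a b : ℕ
      a = p i ∸ suc i
      b = p j ∸ suc j
      ei : p i ≡ i + suc a
      ei = diagonal-arm i i<λ
      ej : p j ≡ j + suc b
      ej = diagonal-arm j j<λj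

    -- A box (i,j) in a diagonal row i of arm a whose column is short,
    -- λ_j + e = j: then a = hook + e, so hook = qt would let us shift 2a + 1
    -- down to 2e + 1, i.e. find a diagonal row i′ of arm e; but then
    -- λ_{i′} + λ_j = i′ + j + 1, which parts-sum≢ forbids.
    shortColumn-box : ∀ i j q → i < p i → p j ≤ j → j < p i → hook la i j ≢ q * t
    shortColumn-box i j q i<λ λj≤j j<λ hq = parts-sum≢ i′ j (begin
      p i′ + p j            ≡⟨ cong (_+ p j) ei′ ⟩
      (i′ + suc e) + p j    ≡⟨ regroup i′ e (p j) ⟩
      suc (i′ + (p j + e))  ≡⟨ cong (λ z → suc (i′ + z)) ej ⟩
      suc (i′ + j)          ∎)
      where
      open ≡-Reasoning
      regroup : ∀ i e P → (i + suc e) + P ≡ suc (i + (P + e))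
      regroup = solve-∀
      a e : ℕ
      a = p i ∸ suc i
      e = j ∸ p j
      ei : p i ≡ i + suc a
      ei = diagonal-arm i i<λ
      ej : p j + e ≡ j
      ej = m+[n∸m]≡n λj≤j
      a≡e+qt : a ≡ e + q * t
      a≡e+qt = trans (sym (arm-excess j<λ ei ej)) (trans (cong (_+ e) hq) (+-comm (q * t) e))
      row : DiagonalRow e
      row = MD→diagonalRow′ (shiftDownMany closed q e
              (subst (λ z → MD la (suc (2 * z))) a≡e+qt (diagonalRow→MD (i , ei))))
      i′ : ℕ
      i′ = proj₁ row
      ei′ : p i′ ≡ i′ + suc e
      ei′ = proj₂ row

    diagonal-box : ∀ i j → i < p i → j < p i → ¬ (t ∣ hook la i j)
    diagonal-box i j i<λ j<λ (divides q hq) with j <? p j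
    ... | yes j<λj = crossing-box i j q i<λ j<λj j<λ hq
    ... | no  j≮λj = shortColumn-box i j q i<λ (≮⇒≥ j≮λj) j<λ hq

    -- Every box has a diagonal row or a diagonal column, and hooks are
    -- symmetric, so diagonal-box covers all boxes.
    conds⇒core : IsCore t la
    conds⇒core i j j<λ div with i <? p i
    ... | yes i<λ = diagonal-box i j i<λ j<λ div
    ... | no  i≮λ with hook-sym i j j<λ
    ...   | i<λj , hooks≡ with j <? p j
    ...     | yes j<λj = diagonal-box j i j<λj i<λj (subst (t ∣_) hooks≡ div)
    ...     | no  j≮λj = <-irrefl refl (begin-strict
              i    <⟨ i<λj ⟩
              p j  ≤⟨ ≮⇒≥ j≮λj ⟩
              j    <⟨ j<λ ⟩
              p i  ≤⟨ ≮⇒≥ i≮λ ⟩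
              i    ∎)
      where open ≤-Reasoning

-- 5. The poset P(s,k) and its nice order ideals

n≤1+2⌊n/2⌋ : ∀ n → n ≤ suc (2 * ⌊ n /2⌋)
n≤1+2⌊n/2⌋ zero          = z≤n
n≤1+2⌊n/2⌋ (suc zero)    = s≤s z≤n
n≤1+2⌊n/2⌋ (suc (suc n)) rewrite *-suc 2 ⌊ n /2⌋ = s≤s (s≤s (n≤1+2⌊n/2⌋ n))

2⌈n/2⌉≤1+n : ∀ n → 2 * ⌈ n /2⌉ ≤ suc n
2⌈n/2⌉≤1+n zero          = z≤n
2⌈n/2⌉≤1+n (suc zero)    = s≤s (s≤s z≤n)
2⌈n/2⌉≤1+n (suc (suc n)) rewrite *-suc 2 ⌈ n /2⌉ = s≤s (s≤s (2⌈n/2⌉≤1+n n))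

⌊n/2⌋<pos : ∀ {n} → 1 ≤ n → ⌊ n /2⌋ < n
⌊n/2⌋<pos {suc n} _ = ⌊n/2⌋<n n

-- a + 1 ≤ i + 1 iff a ≤ i; used to pass between the index i ≥ 1 of the paper
-- and the offset u = i − 1.
+1≤suc⇒≤ : ∀ {a u} → a + 1 ≤ suc u → a ≤ u
+1≤suc⇒≤ {a} {u} le = s≤s⁻¹ (subst (_≤ suc u) (+-comm a 1) le)

≤⇒+1≤suc : ∀ {a u} → a ≤ u → a + 1 ≤ suc u
≤⇒+1≤suc {a} {u} le = subst (_≤ suc u) (+-comm 1 a) (s≤s le)

+1≰0 : ∀ {a} → ¬ (a + 1 ≤ 0)
+1≰0 {a} le with m+n≤o⇒n≤o a le
... | ()

module OrderIdeals (s k : ℕ) (s≥1 : 1 ≤ s) (k≥1 : 1 ≤ k) where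

  instance
    s-nonZero : NonZero s
    s-nonZero = >-nonZero s≥1

  w : ℕ
  w = ⌊ s /2⌋

  c : ℕ
  c = ⌈ s + k /2⌉

  w<s : w < s
  w<s = ⌊n/2⌋<pos s≥1

  -- ⌈(s+1)/2⌉ = ⌊s/2⌋ + 1 and k ≥ 1.
  w<c : w < c
  w<c = ⌈n/2⌉-mono (≤-trans (≤-reflexive (+-comm 1 s)) (+-monoʳ-≤ s k≥1))

  -- The odd number 2u + 1 + 2sj, of level j and offset u; the paper's
  -- 2i − 1 + 2sj with i = u + 1.
  pt : ℕ → ℕ → ℕ
  pt j u = suc (2 * u + 2 * s * j)

  pt-unfold : ∀ j u → (2 * suc u ∸ 1) + 2 * s * j ≡ pt j u
  pt-unfold j u = cong (_+ 2 * s * j) (+-suc u (u + 0))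

  pt-zero : ∀ u → pt 0 u ≡ suc (2 * u)
  pt-zero u = cong suc (trans (cong (2 * u +_) (*-zeroʳ (2 * s))) (+-identityʳ (2 * u)))

  pt-step : ∀ j v t′ → pt (suc j) (v + t′) ≡ pt j v + 2 * s + 2 * t′
  pt-step j v t′ = identity s j v t′
    where
    identity : ∀ s j v t → suc (2 * (v + t) + 2 * s * suc j) ≡ suc (2 * v + 2 * s * j) + 2 * s + 2 * t
    identity = solve-∀

  two-offsets : ∀ y t′ → y + 2 * s + 2 * t′ ≡ y + 2 * (s + t′)
  two-offsets y t′ = trans (+-assoc y (2 * s) (2 * t′)) (cong (y +_) (sym (*-distribˡ-+ 2 s t′)))

  odd-decompose : ∀ a → suc (2 * a) ≡ pt (a / s) (a % s)
  odd-decompose a = trans (cong (λ z → suc (2 * z)) (m≡m%n+[m/n]*n a s)) (regroup (a % s) (a / s) s)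
    where
    regroup : ∀ r q s → suc (2 * (r + q * s)) ≡ suc (2 * r + 2 * s * q)
    regroup = solve-∀

  -- The offsets present at level j form two bands: the left band
  -- jk ≤ u < ⌊s/2⌋ (from L(s,k)) and the right band jk + ⌈(s+k)/2⌉ ≤ u < s
  -- (from R(s,k)).
  Band : ℕ → ℕ → ℕ → Set
  Band lo top u = lo ≤ u × suc u ≤ top

  data InBand (j u : ℕ) : Set where
    left  : Band (j * k) w u → InBand j u
    right : Band (j * k + c) s u → InBand j u

  InBand-bounded : ∀ {j u} → InBand j u → u < s
  InBand-bounded (left (_ , u<w)) = <-trans u<w w<s
  InBand-bounded (right (_ , u<s)) = u<s

  gap : ∀ {j u} → w ≤ u → u < c → ¬ InBand j u
  gap w≤u u<c (left (_ , u<w))  = <-irrefl refl (<-≤-trans u<w w≤u)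
  gap {j} w≤u u<c (right (lo , _)) = <-irrefl refl (<-≤-trans u<c (m+n≤o⇒n≤o (j * k) lo))

  Band-down : ∀ {lo top u t′} → t′ ≤ k → Band (k + lo) top u → t′ ≤ u × Band lo top (u ∸ t′)
  Band-down {lo} {top} {u} {t′} t′≤k (k+lo≤u , u<top) =
    ≤-trans t′≤k (m+n≤o⇒m≤o k k+lo≤u) ,
    m+n≤o⇒m≤o∸n lo (≤-trans (+-monoʳ-≤ lo t′≤k) (≤-trans (≤-reflexive (+-comm lo k)) k+lo≤u)) ,
    ≤-trans (s≤s (m∸n≤m u t′)) u<top

  InBand-down : ∀ {j u t′} → t′ ≤ k → InBand (suc j) u → t′ ≤ u × InBand j (u ∸ t′)
  InBand-down t′≤k (left band) = map₂ left (Band-down t′≤k band)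
  InBand-down {j} {u} t′≤k (right (lo , hi)) =
    map₂ right (Band-down t′≤k (subst (_≤ u) (+-assoc k (j * k) c) lo , hi))

  fromP : ∀ {x} → InP s k x → Σ ℕ λ j → Σ ℕ λ u → x ≡ pt j u × InBand j u
  fromP (inL (j , zero  , lo , _  , _ ))  = ⊥-elim (+1≰0 lo)
  fromP (inL (j , suc u , lo , hi , eq)) = j , u , trans eq (pt-unfold j u) , left (+1≤suc⇒≤ lo , hi)
  fromP (inR (j , zero  , lo , _  , _ ))  = ⊥-elim (+1≰0 lo)
  fromP (inR (j , suc u , lo , hi , eq)) = j , u , trans eq (pt-unfold j u) , right (+1≤suc⇒≤ lo , hi)

  toP : ∀ {j u} → InBand j u → InP s k (pt j u)
  toP {j} {u} (left (lo , hi)) = inL (j , suc u , ≤⇒+1≤suc lo , hi , sym (pt-unfold j u))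
  toP {j} {u} (right (lo , hi)) = inR (j , suc u , ≤⇒+1≤suc lo , hi , sym (pt-unfold j u))

  InP-pos : ∀ {x} → InP s k x → 0 < x
  InP-pos px with fromP px
  ... | _ , _ , refl , _ = z<s

  offset : ∀ {t} → s ≤ t → t ≤ s + k → Σ ℕ λ t′ → t′ ≤ k × t ≡ s + t′
  offset {t} s≤t t≤s+k =
    t ∸ s , +-cancelˡ-≤ s (t ∸ s) k (subst (_≤ s + k) (sym (m+[n∸m]≡n s≤t)) t≤s+k) , sym (m+[n∸m]≡n s≤t)

  -- Shift-closure: an element of level ≥ 1 covers the element 2(s + t′)
  -- below it, which lies in the ideal; an element of level 0 is below 2s.
  ideal⇒shiftClosed : ∀ {D} → IsOrderIdeal s k D → ∀ {t′} → t′ ≤ k → ShiftClosed (s + t′) D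
  ideal⇒shiftClosed {D} (sub , closed) {t′} t′≤k h dh big with fromP (sub h dh)
  ... | zero , u , refl , band = ⊥-elim (<-asym big (begin-strict
        pt 0 u         ≡⟨ pt-zero u ⟩
        suc (2 * u)    <⟨ s≤s (≤-reflexive (sym (+-suc u (u + 0)))) ⟩
        2 * suc u      ≤⟨ *-monoʳ-≤ 2 (InBand-bounded band) ⟩
        2 * s          ≤⟨ *-monoʳ-≤ 2 (m≤m+n s t′) ⟩
        2 * (s + t′)   ∎))
    where open ≤-Reasoning
  ... | suc j , u , refl , band =
        subst D (sym removed) (closed (pt j v) (pt (suc j) u) below above (step here below above cover) dh)
    where
    t′≤u : t′ ≤ u
    t′≤u = proj₁ (InBand-down t′≤k band)
    v : ℕ
    v = u ∸ t′
    below : InP s k (pt j v)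
    below = toP (proj₂ (InBand-down t′≤k band))
    above : InP s k (pt (suc j) u)
    above = sub _ dh
    up : pt (suc j) u ≡ pt j v + 2 * s + 2 * t′
    up = trans (cong (pt (suc j)) (sym (m∸n+n≡m t′≤u))) (pt-step j v t′)
    cover : Covers s k (pt j v) (pt (suc j) u)
    cover = t′ , t′≤k , up
    removed : pt (suc j) u ∸ 2 * (s + t′) ≡ pt j v
    removed = trans (cong (_∸ 2 * (s + t′)) (trans up (two-offsets (pt j v) t′))) (m+n∸n≡m (pt j v) (2 * (s + t′)))

  nice⇒sumFree : ∀ {D} → IsNice s k D → ∀ {t′} → t′ ≤ k → SumFree (s + t′) D
  nice⇒sumFree nice {t′} t′≤k h₁ h₂ d₁ d₂ sum =
    nice (h₁ , h₂ , t′ , d₁ , d₂ , t′≤k , trans sum (*-distribˡ-+ 2 s t′))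

  niceIdeal⇒conditions : ∀ {D} → NiceOrderIdeal s k D → MultiConditions s k D
  niceIdeal⇒conditions (ideal , nice) t s≤t t≤s+k with offset s≤t t≤s+k
  ... | t′ , t′≤k , refl = ideal⇒shiftClosed ideal t′≤k , nice⇒sumFree nice t′≤k

  -- The heart is membersInBand: an element pt j u
  -- (u < s) of D has its offset in a band, shown by induction on the level.
  module FromConditions {D : ℕ → Set} (conditions : MultiConditions s k D) where

    shiftClosed : ∀ {t′} → t′ ≤ k → ShiftClosed (s + t′) D
    shiftClosed t′≤k = proj₁ (conditions _ (m≤m+n s _) (+-monoʳ-≤ s t′≤k))

    sumFree : ∀ {t′} → t′ ≤ k → SumFree (s + t′) D
    sumFree t′≤k = proj₂ (conditions _ (m≤m+n s _) (+-monoʳ-≤ s t′≤k))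

    coverDown : ∀ y {t′} → t′ ≤ k → 0 < y → D (y + 2 * s + 2 * t′) → D y
    coverDown y {t′} t′≤k y>0 d = shiftDown {t = s + t′} (shiftClosed t′≤k) y>0 (subst D (two-offsets y t′) d)

    stepDown : ∀ j v {t′} → t′ ≤ k → D (pt (suc j) (v + t′)) → D (pt j v)
    stepDown j v {t′} t′≤k d = coverDown (pt j v) t′≤k z<s (subst D (pt-step j v t′) d)

    -- No element of level ≥ 1 has offset u < k: stepping down reaches
    -- pt 0 0 = 1, and pt 1 u + 1 = 2(s + u + 1) with u + 1 ≤ k.
    noLowMember : ∀ j u → u < k → ¬ D (pt (suc j) u)
    noLowMember zero    u u<k d = sumFree u<k (pt 1 u) (pt 0 0) d (stepDown 0 0 (<⇒≤ u<k) d) (sum-with-one s u)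
      where
      sum-with-one : ∀ s u → suc (2 * u + 2 * s * 1) + suc (2 * 0 + 2 * s * 0) ≡ 2 * (s + suc u)
      sum-with-one = solve-∀
    noLowMember (suc j) u u<k d = noLowMember j 0 k≥1 (stepDown (suc j) 0 (<⇒≤ u<k) d)

    -- Level 0: an offset in the gap would give pt 0 u + pt 0 u = 2t with
    -- t = 2u + 1 ∈ [s, s+k].
    bandZero : ∀ u → u < s → D (pt 0 u) → InBand 0 u
    bandZero u u<s d with suc u ≤? w | c ≤? u
    ... | yes onLeft  | _         = left (z≤n , onLeft)
    ... | no  _       | yes onRight = right (onRight , u<s)
    ... | no  notLeft | no notRight =
          ⊥-elim (proj₂ (conditions (suc (2 * u)) lower upper) (pt 0 u) (pt 0 u) d d
                   (trans (cong₂ _+_ (pt-zero u) (pt-zero u)) (twice u)))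
      where
      twice : ∀ u → suc (2 * u) + suc (2 * u) ≡ 2 * suc (2 * u)
      twice = solve-∀
      lower : s ≤ suc (2 * u)
      lower = ≤-trans (n≤1+2⌊n/2⌋ s) (s≤s (*-monoʳ-≤ 2 (s≤s⁻¹ (≰⇒> notLeft))))
      upper : suc (2 * u) ≤ s + k
      upper = s≤s⁻¹ (begin
        suc (suc (2 * u))  ≡⟨ sym (*-suc 2 u) ⟩
        2 * suc u          ≤⟨ *-monoʳ-≤ 2 (≰⇒> notRight) ⟩
        2 * c              ≤⟨ 2⌈n/2⌉≤1+n (s + k) ⟩
        suc (s + k)        ∎)
        where open ≤-Reasoning

    -- An element pt (j+1) u with ⌊s/2⌋ ≤ u < ⌊s/2⌋ + k steps down to
    -- pt j ⌊s/2⌋, whose offset is in the gap.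
    gapMember : ∀ j u → w ≤ u → u < w + k → D (pt (suc j) u) → (D (pt j w) → InBand j w) → ⊥
    gapMember j u w≤u u<w+k d level-j =
      gap ≤-refl w<c (level-j (stepDown j w t≤k (subst (λ z → D (pt (suc j) z)) u≡w+t d)))
      where
      u≡w+t : u ≡ w + (u ∸ w)
      u≡w+t = sym (m+[n∸m]≡n w≤u)
      t≤k : u ∸ w ≤ k
      t≤k = ≤-trans (∸-monoˡ-≤ w (<⇒≤ u<w+k)) (≤-reflexive (m+n∸m≡n w k))

    -- Level j + 1: offsets u < k are excluded by noLowMember; otherwise
    -- pt j (u − k) ∈ D lies in a band at level j, and adding k keeps it in the
    -- same band at level j + 1 — unless it leaves the left band, which
    -- gapMember excludes.
    bandSuc : ∀ j u → u < s → D (pt (suc j) u) → (∀ v → v < s → D (pt j v) → InBand j v) → InBand (suc j) u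
    bandSuc j u u<s d level-j with u <? k
    ... | yes u<k = ⊥-elim (noLowMember j u u<k d)
    ... | no  u≮k = lift (level-j v (≤-<-trans (m∸n≤m u k) u<s) (stepDown j v ≤-refl (subst (λ z → D (pt (suc j) z)) u≡v+k d)))
      where
      v : ℕ
      v = u ∸ k
      u≡v+k : u ≡ v + k
      u≡v+k = sym (m∸n+n≡m (≮⇒≥ u≮k))
      raise : ∀ {lo} → lo ≤ v → k + lo ≤ u
      raise lo≤v = ≤-trans (+-monoʳ-≤ k lo≤v) (≤-reflexive (trans (+-comm k v) (sym u≡v+k)))
      lift : InBand j v → InBand (suc j) u
      lift (right (lo , _)) = right (subst (_≤ u) (sym (+-assoc k (j * k) c)) (raise lo) , u<s)
      lift (left (lo , v<w)) with suc u ≤? w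
      ... | yes onLeft  = left (raise lo , onLeft)
      ... | no  notLeft = ⊥-elim (gapMember j u (s≤s⁻¹ (≰⇒> notLeft)) u<w+k d (level-j w w<s))
        where
        u<w+k : u < w + k
        u<w+k = subst (_< w + k) (sym u≡v+k) (+-monoˡ-< k v<w)

    membersInBand : ∀ j u → u < s → D (pt j u) → InBand j u
    membersInBand zero          = bandZero
    membersInBand (suc j) u u<s d = bandSuc j u u<s d (membersInBand j)

    membersInP : Odd D → ∀ h → D h → InP s k h
    membersInP odd h dh with odd h dh
    ... | a , refl = subst (InP s k) (sym (odd-decompose a))
                       (toP (membersInBand (a / s) (a % s) (m%n<n a s) (subst D (odd-decompose a) dh)))

    downward : ∀ x y → InP s k x → InP s k y → Below s k x y → D y → D x
    downward x y px py here dy = dy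
    downward x z px pz (step {y = y} below py _ (t′ , t′≤k , z≡)) dz =
      downward x y px py below (coverDown y t′≤k (InP-pos py) (subst D z≡ dz))

    nice : IsNice s k D
    nice (h₁ , h₂ , t′ , d₁ , d₂ , t′≤k , sum) = sumFree t′≤k h₁ h₂ d₁ d₂ (trans sum (sym (*-distribˡ-+ 2 s t′)))

    conditions⇒niceIdeal : Odd D → NiceOrderIdeal s k D
    conditions⇒niceIdeal odd = (membersInP odd , downward) , nice

theorem2p5 : (s k : ℕ) → 1 ≤ s → 1 ≤ k → (la : List ℕ) → IsPartition la → SelfConjugate la
           → IsMultiCore s k la ⇔ NiceOrderIdeal s k (MD la)
theorem2p5 s k s≥1 k≥1 la (lk , _) sc = mk⇔ toIdeal fromIdeal
  where
  open OrderIdeals s k s≥1 k≥1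
  open SelfConjugateDiagram la lk sc using (MD-odd)
  open CoreCriterion la lk sc

  toIdeal : IsMultiCore s k la → NiceOrderIdeal s k (MD la)
  toIdeal multiCore = FromConditions.conditions⇒niceIdeal conditions MD-odd
    where
    conditions : MultiConditions s k (MD la)
    conditions t s≤t t≤s+k = core⇒shiftClosed t core , core⇒sumFree t core
      where
      core : IsCore t la
      core = multiCore t s≤t t≤s+k

  fromIdeal : NiceOrderIdeal s k (MD la) → IsMultiCore s k la
  fromIdeal niceIdeal t s≤t t≤s+k = conds⇒core t (proj₁ conditions) (proj₂ conditions)
    where
    conditions : ShiftClosed t (MD la) × SumFree t (MD la)
    conditions = niceIdeal⇒conditions niceIdeal t s≤t t≤s+k
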